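{- Let $n\geq 1$ and let $C=(a_1,\dots,a_m)$ be a cycle in the Fibonacci-sum graph $G_n$ of length $m\geq 6$. Then $C$ has a chord that has exactly two vertices of the cycle on one side of it; that is, there is an index $i$ such that $\{a_i,a_{i+3}\}$ (indices taken modulo $m$) is an edge of $G_n$, so that $a_i,a_{i+1},a_{i+2},a_{i+3}$ form a $4$-cycle.
   Context: The Fibonacci numbers are defined by $F_0=0$, $F_1=1$ and $F_m=F_{m-1}+F_{m-2}$ for $m\geq 2$. For each integer $n\geq 1$, the Fibonacci-sum graph $G_n$ is the simple graph with vertex set $\{1,2,\dots,n\}$ in which distinct vertices $i,j$ are adjacent if and only if $i+j$ is a Fibonacci number. -}

module Defs where

open import Data.Nat using (ℕ; zero; suc; _+_; _≤_; _<_; NonZero)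
open import Data.Nat.DivMod using (_%_; m%n<n)
open import Data.Fin using (Fin; toℕ; fromℕ<)
open import Data.Product using (∃; _×_)
open import Relation.Binary.PropositionalEquality using (_≡_; _≢_)

fib : ℕ → ℕ
fib zero = zero
fib (suc zero) = suc zero
fib (suc (suc m)) = fib (suc m) + fib m

IsFib : ℕ → Set
IsFib k = ∃ λ j → fib j ≡ k

Adj : ℕ → ℕ → ℕ → Set
Adj n i j = (1 ≤ i × i ≤ n) × (1 ≤ j × j ≤ n) × i ≢ j × IsFib (i + j)

shift : ∀ {m} .{{_ : NonZero m}} → Fin m → ℕ → Fin m
shift {m} i k = fromℕ< (m%n<n (toℕ i + k) m)

IsCycle : (n m : ℕ) .{{_ : NonZero m}} → (Fin m → ℕ) → Set
IsCycle n m a = (∀ i j → a i ≡ a j → i ≡ j) × (∀ i → Adj n (a i) (a (shift i 1)))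

module Submission where

-- Idea: look at the largest vertex M of C and its cycle-neighbours p and q.
-- If q < p, then M + q < M + p < 2(M + q) forces M + q = F_{r+2} and
-- M + p = F_{r+3}; since q ≥ 1 we get p > F_{r+1}, so the predecessor d of p
-- satisfies F_{r+1} < d + p < M + p = F_{r+3}, whence d + p = F_{r+2} and
-- d + q = 2F_{r+2} - F_{r+3} = F_r.  Thus d and q (three steps apart on C)
-- are adjacent; the case p < q is the mirror image.

open import Defs
open import Data.Nat using (ℕ; zero; suc; _+_; _∸_; _≤_; _<_; _≤′_; ≤′-refl; ≤′-step; z≤n; s≤s; s≤s⁻¹; NonZero)
open import Data.Nat.Properties
open import Data.Nat.DivMod using (_%_; m%n<n; m<n⇒m%n≡m; [m+n]%n≡m%n; %-distribˡ-+; m%n%n≡m%n)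
open import Data.Nat.Tactic.RingSolver using (solve-∀)
open import Data.Fin using (Fin; toℕ) renaming (zero to fzero)
open import Data.Fin.Properties using (toℕ-fromℕ<; toℕ-injective; toℕ<n)
open import Data.List using (allFin)
open import Data.List.Extrema.Nat using (argmax; f[xs]≤f[argmax])
open import Data.List.Membership.Propositional.Properties using (∈-allFin)
import Data.List.Relation.Unary.All as All
open import Data.Empty using (⊥-elim)
open import Data.Product using (∃; _×_; _,_; proj₁; proj₂)
open import Relation.Binary.Definitions using (Tri; tri<; tri≈; tri>)
open import Relation.Binary.PropositionalEquality

fib-≤-suc : ∀ k → fib k ≤ fib (suc k)
fib-≤-suc zero = z≤n
fib-≤-suc (suc zero) = ≤-refl
fib-≤-suc (suc (suc k)) = m≤m+n (fib (suc (suc k))) (fib (suc k))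

fib-monotone′ : ∀ {i j} → i ≤′ j → fib i ≤ fib j
fib-monotone′ ≤′-refl = ≤-refl
fib-monotone′ {i} {suc j} (≤′-step i≤j) = ≤-trans (fib-monotone′ i≤j) (fib-≤-suc j)

fib-monotone : ∀ {i j} → i ≤ j → fib i ≤ fib j
fib-monotone i≤j = fib-monotone′ (≤⇒≤′ i≤j)

fib-reflects-< : ∀ {i j} → fib i < fib j → i < j
fib-reflects-< lt = ≰⇒> (λ j≤i → <⇒≱ lt (fib-monotone j≤i))

fib-doubling : ∀ k → fib k + fib k ≤ fib (2 + k)
fib-doubling k = +-monoˡ-≤ (fib k) (fib-≤-suc k)

fib-consecutive : ∀ {q p} → fib q < fib p → fib p < fib q + fib q →
                  ∃ λ r → q ≡ 2 + r × p ≡ 3 + r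
fib-consecutive {q} {p} lt gap = by-index q p (≤-antisym p≤1+q (fib-reflects-< lt)) lt gap
  where
  p≤1+q : p ≤ suc q
  p≤1+q = ≮⇒≥ (λ 1+q<p → <⇒≱ gap (≤-trans (fib-doubling q) (fib-monotone 1+q<p)))
  -- F_0 < F_1 < 2F_0 and F_1 < F_2 are impossible, so q ≥ 2.
  by-index : ∀ q p → p ≡ suc q → fib q < fib p → fib p < fib q + fib q →
             ∃ λ r → q ≡ 2 + r × p ≡ 3 + r
  by-index zero .1 refl _ ()
  by-index (suc zero) .2 refl (s≤s ()) _
  by-index (suc (suc r)) .(3 + r) refl _ _ = r , refl , refl

fib-squeezed : ∀ r {j} → fib (suc r) < fib j → fib j < fib (3 + r) → j ≡ 2 + r
fib-squeezed r lo hi = ≤-antisym (s≤s⁻¹ (fib-reflects-< hi)) (fib-reflects-< lo)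

fib-double : ∀ r → fib (2 + r) + fib (2 + r) ≡ fib r + fib (3 + r)
fib-double r = rearrange (fib (suc r)) (fib r)
  where
  rearrange : ∀ x y → (x + y) + (x + y) ≡ y + ((x + y) + x)
  rearrange = solve-∀

sums-consecutive : ∀ {b M c} → IsFib (b + M) → IsFib (M + c) → c < b → b < M →
                   ∃ λ r → b + M ≡ fib (3 + r) × M + c ≡ fib (2 + r)
sums-consecutive {b} {M} {c} (p , bM) (q , Mc) c<b b<M =
  from-indices (fib-consecutive (subst₂ _<_ (sym Mc) (sym bM) Mc<bM)
                                (subst₂ (λ x y → x < y + y) (sym bM) (sym Mc) bM<2Mc))
  where
  Mc<bM : M + c < b + M
  Mc<bM = subst (M + c <_) (+-comm M b) (+-monoʳ-< M c<b)
  bM<2Mc : b + M < (M + c) + (M + c)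
  bM<2Mc = <-≤-trans (+-monoˡ-< M b<M) (+-mono-≤ (m≤m+n M c) (m≤m+n M c))
  from-indices : (∃ λ r → q ≡ 2 + r × p ≡ 3 + r) → ∃ λ r → b + M ≡ fib (3 + r) × M + c ≡ fib (2 + r)
  from-indices (r , refl , refl) = r , sym bM , sym Mc

fib-path-chord : ∀ {d b M c} → IsFib (d + b) → IsFib (b + M) → IsFib (M + c) →
                 1 ≤ c → c < b → b < M → d < M → IsFib (d + c)
fib-path-chord {d} {b} {M} {c} (j , db) bM-fib Mc-fib 1≤c c<b b<M d<M
  with sums-consecutive bM-fib Mc-fib c<b b<M
... | r , bM , Mc = r , sym d+c≡Fr
  where
  M<F₂ : M < fib (2 + r)
  M<F₂ = subst (M <_) Mc (m<m+n M 1≤c)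
  -- b + M = F_{r+3} = F_{r+1} + F_{r+2} and M < F_{r+2}, hence F_{r+1} < b.
  F₁<b : fib (suc r) < b
  F₁<b = +-cancelʳ-< M (fib (suc r)) b
           (subst (fib (suc r) + M <_) (trans (+-comm (fib (suc r)) (fib (2 + r))) (sym bM))
              (+-monoʳ-< (fib (suc r)) M<F₂))
  db<F₃ : d + b < fib (3 + r)
  db<F₃ = subst (d + b <_) (trans (+-comm M b) bM) (+-monoˡ-< b d<M)
  db≡F₂ : d + b ≡ fib (2 + r)
  db≡F₂ = trans (sym db) (cong fib (fib-squeezed r {j}
            (subst (fib (suc r) <_) (sym db) (<-≤-trans F₁<b (m≤n+m b d)))
            (subst (_< fib (3 + r)) (sym db) db<F₃)))
  regroup : ∀ d c b M → (d + c) + (b + M) ≡ (d + b) + (M + c)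
  regroup = solve-∀
  d+c≡Fr : d + c ≡ fib r
  d+c≡Fr = +-cancelʳ-≡ (fib (3 + r)) (d + c) (fib r) (begin
    (d + c) + fib (3 + r)     ≡⟨ cong ((d + c) +_) bM ⟨
    (d + c) + (b + M)         ≡⟨ regroup d c b M ⟩
    (d + b) + (M + c)         ≡⟨ cong₂ _+_ db≡F₂ Mc ⟩
    fib (2 + r) + fib (2 + r) ≡⟨ fib-double r ⟩
    fib r + fib (3 + r)       ∎)
    where open ≡-Reasoning

adj-sym : ∀ {n i j} → Adj n i j → Adj n j i
adj-sym {i = i} {j} (ri , rj , i≢j , k , e) = rj , ri , (λ e′ → i≢j (sym e′)) , k , trans e (+-comm i j)

fan-chord : ∀ {n d b M c} → Adj n d b → Adj n b M → Adj n M c → d ≢ c →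
            c < b → b ≤ M → d < M → Adj n d c
fan-chord (rd , _ , _ , db) (_ , _ , b≢M , bM) (_ , rc@(1≤c , _) , _ , Mc) d≢c c<b b≤M d<M =
  rd , rc , d≢c , fib-path-chord db bM Mc 1≤c c<b (≤∧≢⇒< b≤M b≢M) d<M

maximum-position : ∀ {k} (f : Fin (suc k) → ℕ) → ∃ λ i → ∀ j → f j ≤ f i
maximum-position f =
  argmax f fzero (allFin _) , λ j → All.lookup (f[xs]≤f[argmax] {f = f} fzero (allFin _)) (∈-allFin j)

module _ {m : ℕ} .{{_ : NonZero m}} where

  toℕ-shift : ∀ (i : Fin m) k → toℕ (shift i k) ≡ (toℕ i + k) % m
  toℕ-shift i k = toℕ-fromℕ< (m%n<n (toℕ i + k) m)

  %-absorbˡ : ∀ x y → (x % m + y) % m ≡ (x + y) % m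
  %-absorbˡ x y = begin
    (x % m + y) % m         ≡⟨ %-distribˡ-+ (x % m) y m ⟩
    (x % m % m + y % m) % m ≡⟨ cong (λ z → (z + y % m) % m) (m%n%n≡m%n x m) ⟩
    (x % m + y % m) % m     ≡⟨ %-distribˡ-+ x y m ⟨
    (x + y) % m             ∎
    where open ≡-Reasoning

  shift-shift : ∀ (i : Fin m) k l → shift (shift i k) l ≡ shift i (k + l)
  shift-shift i k l = toℕ-injective (begin
    toℕ (shift (shift i k) l) ≡⟨ toℕ-shift (shift i k) l ⟩
    (toℕ (shift i k) + l) % m ≡⟨ cong (λ z → (z + l) % m) (toℕ-shift i k) ⟩
    ((toℕ i + k) % m + l) % m ≡⟨ %-absorbˡ (toℕ i + k) l ⟩
    (toℕ i + k + l) % m       ≡⟨ cong (_% m) (+-assoc (toℕ i) k l) ⟩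
    (toℕ i + (k + l)) % m     ≡⟨ toℕ-shift i (k + l) ⟨
    toℕ (shift i (k + l))     ∎)
    where open ≡-Reasoning

  shift-zero : ∀ (i : Fin m) → shift i 0 ≡ i
  shift-zero i = toℕ-injective (begin
    toℕ (shift i 0)   ≡⟨ toℕ-shift i 0 ⟩
    (toℕ i + 0) % m   ≡⟨ cong (_% m) (+-identityʳ (toℕ i)) ⟩
    toℕ i % m         ≡⟨ m<n⇒m%n≡m (toℕ<n i) ⟩
    toℕ i             ∎)
    where open ≡-Reasoning

  shift-period : ∀ (i : Fin m) k → shift i (k + m) ≡ shift i k
  shift-period i k = toℕ-injective (begin
    toℕ (shift i (k + m))  ≡⟨ toℕ-shift i (k + m) ⟩
    (toℕ i + (k + m)) % m  ≡⟨ cong (_% m) (+-assoc (toℕ i) k m) ⟨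
    (toℕ i + k + m) % m    ≡⟨ [m+n]%n≡m%n (toℕ i + k) m ⟩
    (toℕ i + k) % m        ≡⟨ toℕ-shift i k ⟨
    toℕ (shift i k)        ∎)
    where open ≡-Reasoning

  shift-offset : ∀ (i : Fin m) k → (toℕ (shift i k) + (m ∸ toℕ i)) % m ≡ k % m
  shift-offset i k = begin
    (toℕ (shift i k) + (m ∸ x)) % m ≡⟨ cong (λ z → (z + (m ∸ x)) % m) (toℕ-shift i k) ⟩
    ((x + k) % m + (m ∸ x)) % m     ≡⟨ %-absorbˡ (x + k) (m ∸ x) ⟩
    (x + k + (m ∸ x)) % m           ≡⟨ cong (λ z → (z + (m ∸ x)) % m) (+-comm x k) ⟩
    (k + x + (m ∸ x)) % m           ≡⟨ cong (_% m) (+-assoc k x (m ∸ x)) ⟩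
    (k + (x + (m ∸ x))) % m         ≡⟨ cong (λ z → (k + z) % m) (m+[n∸m]≡n (<⇒≤ (toℕ<n i))) ⟩
    (k + m) % m                     ≡⟨ [m+n]%n≡m%n k m ⟩
    k % m                           ∎
    where
    open ≡-Reasoning
    x : ℕ
    x = toℕ i

  shift-injective : ∀ (i : Fin m) {k l} → k < m → l < m → shift i k ≡ shift i l → k ≡ l
  shift-injective i {k} {l} k<m l<m eq = begin
    k                                    ≡⟨ m<n⇒m%n≡m k<m ⟨
    k % m                                ≡⟨ shift-offset i k ⟨
    (toℕ (shift i k) + (m ∸ toℕ i)) % m ≡⟨ cong (λ j → (toℕ j + (m ∸ toℕ i)) % m) eq ⟩
    (toℕ (shift i l) + (m ∸ toℕ i)) % m ≡⟨ shift-offset i l ⟩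
    l % m                                ≡⟨ m<n⇒m%n≡m l<m ⟩
    l                                    ∎
    where open ≡-Reasoning

module Walk {n m : ℕ} .{{_ : NonZero m}} {a : Fin m → ℕ} (cycle : IsCycle n m a) (i : Fin m) where

  walk : ℕ → ℕ
  walk k = a (shift i k)

  walk-start : walk 0 ≡ a i
  walk-start = cong a (shift-zero i)

  walk-adj : ∀ k → Adj n (walk k) (walk (suc k))
  walk-adj k = subst (λ j → Adj n (walk k) (a j))
                 (trans (shift-shift i k 1) (cong (shift i) (+-comm k 1)))
                 (proj₂ cycle (shift i k))

  walk-wrap : ∀ {j l} → j ≡ l + m → walk j ≡ walk l
  walk-wrap {j} {l} j≡l+m = cong a (trans (cong (shift i) j≡l+m) (shift-period i l))

  walk-distinct : ∀ {k l} → k < m → l < m → k ≢ l → walk k ≢ walk l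
  walk-distinct {k} {l} k<m l<m k≢l eq =
    k≢l (shift-injective i k<m l<m (proj₁ cycle (shift i k) (shift i l) eq))

  walk-chord : ∀ j {l} → j + 3 ≡ l + m → Adj n (walk j) (walk l) →
               ∃ λ j′ → Adj n (a j′) (a (shift j′ 3))
  walk-chord j j+3≡l+m e =
    shift i j , subst (λ v → Adj n (walk j) v)
                  (sym (trans (cong a (shift-shift i j 3)) (walk-wrap j+3≡l+m))) e

-- A cycle of length at least 4 in G_n has a chord {a_j, a_{j+3}} next to its
-- largest vertex M = a i = walk 0: apply fan-chord on the side of the larger
-- of the two neighbours walk 1 and walk (3 + k).
chord-at-maximum : ∀ n k (a : Fin (4 + k) → ℕ) → IsCycle n (4 + k) a →
                   (i : Fin (4 + k)) → (∀ j → a j ≤ a i) →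
                   ∃ λ j → Adj n (a j) (a (shift j 3))
chord-at-maximum n k a cycle i maximal = by-comparison (<-cmp (walk 1) (walk (3 + k)))
  where
  open Walk cycle i
  below-max : ∀ l → walk l ≤ walk 0
  below-max l = subst (walk l ≤_) (sym walk-start) (maximal (shift i l))
  strictly-below : ∀ {l} → l < 4 + k → l ≢ 0 → walk l < walk 0
  strictly-below l<m l≢0 = ≤∧≢⇒< (below-max _) (walk-distinct l<m (s≤s z≤n) l≢0)
  closing : Adj n (walk (3 + k)) (walk 0)
  closing = subst (Adj n (walk (3 + k))) (walk-wrap {4 + k} {0} refl) (walk-adj (3 + k))
  by-comparison : Tri (walk 1 < walk (3 + k)) (walk 1 ≡ walk (3 + k)) (walk (3 + k) < walk 1) →
                  ∃ λ j → Adj n (a j) (a (shift j 3))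
  by-comparison (tri< after<before _ _) = walk-chord (2 + k) {1} (+-comm (2 + k) 3)
    (fan-chord (walk-adj (2 + k)) closing (walk-adj 0)
      (walk-distinct (n≤1+n (3 + k)) (s≤s (s≤s z≤n)) (λ ()))
      after<before (below-max _) (strictly-below (n≤1+n (3 + k)) (λ ())))
  by-comparison (tri≈ _ after≡before _) =
    ⊥-elim (walk-distinct (s≤s (s≤s z≤n)) ≤-refl (λ ()) after≡before)
  by-comparison (tri> _ _ before<after) = walk-chord (3 + k) {2} (+-comm (3 + k) 3)
    (adj-sym (fan-chord (adj-sym (walk-adj 1)) (adj-sym (walk-adj 0)) (adj-sym closing)
      (walk-distinct (s≤s (s≤s (s≤s z≤n))) ≤-refl (λ ()))
      before<after (below-max _) (strictly-below (s≤s (s≤s (s≤s z≤n))) (λ ()))))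

theorem11 : (n m : ℕ) → 1 ≤ n → .{{_ : NonZero m}} → 6 ≤ m → (a : Fin m → ℕ) →
    IsCycle n m a → ∃ λ i → Adj n (a i) (a (shift i 3))
theorem11 n (suc (suc (suc (suc k)))) _ (s≤s (s≤s (s≤s (s≤s _)))) a cycle =
  chord-at-maximum n k a cycle (proj₁ maximum) (proj₂ maximum)
  where
  maximum : ∃ λ i → ∀ j → a j ≤ a i
  maximum = maximum-position a
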